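{- For every labelled transition system $T$, the Kripke structure $\mathsf{ks}(T)$ is reversible and $\mathsf{ks}^{ -1}(\mathsf{ks}(T))$ is isomorphic to $T$; that is, $\mathsf{ks}^{ -1}\circ\mathsf{ks}=\mathrm{Id}$.
   Context: A Kripke structure is $K=\langle S, AP, \to, L\rangle$ with $S$ a set of states, $AP$ a set of atomic propositions, $\to\,\subseteq S\times S$ a total transition relation, and $L: S\to 2^{AP}$. A labelled transition system (LTS) is $T=\langle S, Act, \to\rangle$ with a special silent action $\tau\notin Act$ and a total transition relation $\to\,\subseteq S\times(Act\cup\{\tau\})\times S$. The embedding $\mathsf{ks}$: $\mathsf{ks}(T)=\langle S', AP, \to', L\rangle$ where $S' = S\cup\{(s,a,t)\in\,\to \mid a\neq\tau\}$, $AP = Act\cup\{\bot\}$ with $\bot\notin Act$ fresh, $\to'$ is the least relation such that for every transition $(s,a,t)$ with $a\neq\tau$, $s\to'(s,a,t)$ and $(s,a,t)\to' t$, and $s\to' t$ whenever $s\xrightarrow{\tau}t$; $L(s)=\{\bot\}$ for $s\in S$ and $L((s,a,t))=\{a\}$. Reversibility: a Kripke structure is reversible iff (1) $AP = Act\cup\{\bot\}$ for some set $Act$; (2) $|L(s)|=1$ for all states $s$; (3) for every $s$ with $\bot\notin L(s)$, $s\to s'$ and $s\to s''$ imply $s'=s''$ and $L(s')=\{\bot\}$. The reverse translation: for a reversible Kripke structure $K=\langle S,AP,\to,L\rangle$, $\mathsf{ks}^{ -1}(K)=\langle S'',Act,\to''\rangle$ with $S''=\{s\in S\mid L(s)=\{\bot\}\}$,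 $Act=AP\setminus\{\bot\}$, and $\to''$ the least relation such that $s\xrightarrow{\tau}s'$ whenever $s\to s'$ and $L(s)=L(s')$, and $s\xrightarrow{a}s'$ whenever $s\to s''$, $a\in L(s'')\setminus\{\bot\}$ and $s''\to s'$. -}

module Defs where

open import Data.Maybe using (Maybe; just; nothing)
open import Data.Product using (Σ; ∃; ∃-syntax; _×_; _,_)
open import Data.Sum using (_⊎_; inj₁; inj₂)
open import Data.Refinement using (Refinement-syntax)
open import Function.Bundles using (_⇔_; _↔_; Inverse)
open import Relation.Binary.PropositionalEquality using (_≡_)

-- Labelled transition systems over an action set Act.
-- Labels are  Maybe Act : nothing = the silent action τ (τ ∉ Act).
-- The transition relation is a (Set-valued) relation.

record LTS (Act : Set) : Set₁ where
  field
    State : Set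
    _—[_]→_ : State → Maybe Act → State → Set

TotalLTS : ∀ {Act} → LTS Act → Set
TotalLTS T = ∀ s → ∃[ α ] ∃[ t ] (LTS._—[_]→_ T s α t)

record Kripke (AP : Set) : Set₁ where
  field
    State : Set
    _⟶_   : State → State → Set
    L     : State → AP → Set

TotalK : ∀ {AP} → Kripke AP → Set
TotalK K = ∀ s → ∃[ t ] (Kripke._⟶_ K s t)

_≐_ : ∀ {AP : Set} → (AP → Set) → (AP → Set) → Set
X ≐ Y = ∀ x → X x ⇔ Y x

｛_｝ : ∀ {AP : Set} → AP → AP → Set
｛ y ｝ x = x ≡ y

IsSingleton : ∀ {AP : Set} → (AP → Set) → Set
IsSingleton {AP} X = Σ AP λ y → X ≐ ｛ y ｝

-- ⊥ (the fresh proposition) is represented by  nothing : Maybe Act,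
-- so AP = Act ∪ {⊥} is  Maybe Act  (condition (1) holds by typing).
Reversible : ∀ {Act} → Kripke (Maybe Act) → Set
Reversible K =
    (∀ s → IsSingleton (L s))
  × (∀ s → ¬⊥ s → ∀ s' s'' → s ⟶ s' → s ⟶ s'' → (s' ≡ s'') × (L s' ≐ ｛ nothing ｝))
  where
  open Kripke K
  ¬⊥ : State → Set
  ¬⊥ s = L s nothing → Data.Empty.⊥
    where import Data.Empty

module _ {Act : Set} (T : LTS Act) where
  open LTS T renaming (State to S)

  VisTrans : Set
  VisTrans = Σ S λ s → Σ Act λ a → Σ S λ t → s —[ just a ]→ t

  data KsStep : S ⊎ VisTrans → S ⊎ VisTrans → Set where
    enter : ∀ s a t (p : s —[ just a ]→ t) → KsStep (inj₁ s) (inj₂ (s , a , t , p))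
    leave : ∀ s a t (p : s —[ just a ]→ t) → KsStep (inj₂ (s , a , t , p)) (inj₁ t)
    silent : ∀ s t → s —[ nothing ]→ t → KsStep (inj₁ s) (inj₁ t)

  KsLabel : S ⊎ VisTrans → Maybe Act → Set
  KsLabel (inj₁ s) = ｛ nothing ｝
  KsLabel (inj₂ (s , a , t , p)) = ｛ just a ｝

  ks : Kripke (Maybe Act)
  ks = record { State = S ⊎ VisTrans ; _⟶_ = KsStep ; L = KsLabel }

-- The reverse translation ks⁻¹ (AP = Maybe Act, ⊥ = nothing,
-- Act = AP ∖ {⊥} = the  just  elements).
-- States: { s ∈ S ∣ L(s) = {⊥} } as a refinement type (irrelevant proof).

module _ {Act : Set} (K : Kripke (Maybe Act)) where
  open Kripke K renaming (State to S)

  InvState : Set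
  InvState = [ s ∈ S ∣ L s ≐ ｛ nothing ｝ ]

  open import Data.Refinement using (value)

  data InvStep : InvState → Maybe Act → InvState → Set where
    τ-step : ∀ s s' → value s ⟶ value s' → L (value s) ≐ L (value s')
           → InvStep s nothing s'
    a-step : ∀ s s' (s'' : S) (a : Act) → value s ⟶ s'' → L s'' (just a) → s'' ⟶ value s'
           → InvStep s (just a) s'

  ks⁻¹ : LTS Act
  ks⁻¹ = record { State = InvState ; _—[_]→_ = InvStep }

record _≅_ {Act : Set} (T U : LTS Act) : Set where
  field
    bij  : LTS.State T ↔ LTS.State U
  open Inverse bij using (to)
  field
    resp : ∀ s α t → LTS._—[_]→_ T s α t ⇔ LTS._—[_]→_ U (to s) α (to t)

module Submission where

-- Everything follows from reading off the shape of ks(T).  Its states are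
-- the states of T, labelled {⊥}, together with the visible transitions
-- (s , a , t), labelled {a}; the only edges leaving a transition state go
-- to its target.  Hence
--   * totality and reversibility hold by a case split on the state kind;
--   * the states of ks⁻¹(ks(T)) (those labelled {⊥}) are exactly the
--     embedded states of T, since a transition state is labelled {a} ≠ {⊥};
--   * between embedded states, a τ-step of ks⁻¹ is a silent edge of ks(T)
--     and an a-step is a detour s ⟶ (s , a , t) ⟶ t, i.e. a transition
--     s —[ a ]→ t of T (the detour cannot go through a ⊥-labelled state).
-- The isomorphism is the projection onto the underlying state of T.

open import Defs
open import Data.Maybe using (just; nothing)
open import Data.Product using (_×_; _,_)
open import Data.Sum using (inj₁; inj₂)
open import Data.Refinement using (_,_)
open import Data.Irrelevant using ([_])
open import Data.Empty using (⊥)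
import Data.Empty.Irrelevant as Irrelevant
open import Function.Bundles using (_⇔_; _↔_; mk⇔; mk↔ₛ′; Equivalence)
open import Relation.Binary.PropositionalEquality using (_≡_; refl)

≐-refl : ∀ {AP : Set} {X : AP → Set} → X ≐ X
≐-refl _ = mk⇔ (λ x → x) (λ x → x)

module _ {Act : Set} (T : LTS Act) where
  open LTS T renaming (State to S)
  open Kripke (ks T) using (_⟶_; L)

  ks-total : TotalLTS T → TotalK (ks T)
  ks-total total (inj₁ s) with total s
  ... | just a  , t , p = inj₂ (s , a , t , p) , enter s a t p
  ... | nothing , t , p = inj₁ t , silent s t p
  ks-total total (inj₂ (s , a , t , p)) = inj₁ t , leave s a t p

  ks-singleton-labels : ∀ x → IsSingleton (L x)
  ks-singleton-labels (inj₁ s)             = nothing , ≐-refl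
  ks-singleton-labels (inj₂ (_ , a , _ , _)) = just a  , ≐-refl

  ks-deterministic-off-⊥ : ∀ x → (L x nothing → ⊥) → ∀ x' x'' → x ⟶ x' → x ⟶ x''
                         → (x' ≡ x'') × (L x' ≐ ｛ nothing ｝)
  ks-deterministic-off-⊥ (inj₁ s) not-⊥ _ _ _ _ with not-⊥ refl
  ... | ()
  ks-deterministic-off-⊥ (inj₂ _) _ _ _ (leave s a t p) (leave .s .a .t .p) = refl , ≐-refl

  ks-reversible : Reversible (ks T)
  ks-reversible = ks-singleton-labels , ks-deterministic-off-⊥

  -- A transition state is never labelled {⊥}, so it is not a state of
  -- ks⁻¹(ks(T)); the membership proof is irrelevant, hence so is the
  -- contradiction.
  transition-not-⊥ : ∀ {A : Set} v → .(L (inj₂ v) ≐ ｛ nothing ｝) → A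
  transition-not-⊥ (_ , a , _ , _) labelled-⊥ =
    Irrelevant.⊥-elim (just≢nothing (Equivalence.to (labelled-⊥ (just a)) refl))
    where
    just≢nothing : just a ≡ nothing → ⊥
    just≢nothing ()

  embed : S → InvState (ks T)
  embed s = inj₁ s , [ ≐-refl ]

  project : InvState (ks T) → S
  project (inj₁ s , _)     = s
  project (inj₂ v , [ q ]) = transition-not-⊥ v q

  project-embed : ∀ s → project (embed s) ≡ s
  project-embed _ = refl

  embed-project : ∀ x → embed (project x) ≡ x
  embed-project (inj₁ _ , _)     = refl
  embed-project (inj₂ v , [ q ]) = transition-not-⊥ v q

  states-bijection : InvState (ks T) ↔ S
  states-bijection = mk↔ₛ′ project embed project-embed embed-project

  steps-reflected : ∀ s α t → InvStep (ks T) (embed s) α (embed t) → s —[ α ]→ t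
  steps-reflected s _ t (τ-step _ _ (silent .s .t p) _) = p
  steps-reflected s _ t (a-step _ _ _ a (enter .s .a .t p) refl (leave .s .a .t .p)) = p
  steps-reflected s _ t (a-step _ _ _ a (silent .s _ _) () _)

  steps-preserved : ∀ s α t → s —[ α ]→ t → InvStep (ks T) (embed s) α (embed t)
  steps-preserved s nothing  t p = τ-step _ _ (silent s t p) ≐-refl
  steps-preserved s (just a) t p =
    a-step _ _ (inj₂ (s , a , t , p)) a (enter s a t p) refl (leave s a t p)

  project-respects : ∀ x α y → InvStep (ks T) x α y ⇔ project x —[ α ]→ project y
  project-respects (inj₁ s , _) α (inj₁ t , _) = mk⇔ (steps-reflected s α t) (steps-preserved s α t)
  project-respects (inj₁ _ , _) _ (inj₂ v , [ q ]) = transition-not-⊥ v q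
  project-respects (inj₂ v , [ q ]) _ _ = transition-not-⊥ v q

  ks⁻¹∘ks≅id : ks⁻¹ (ks T) ≅ T
  ks⁻¹∘ks≅id = record { bij = states-bijection ; resp = project-respects }

proposition4p14 : ∀ {Act : Set} (T : LTS Act) → TotalLTS T →
    TotalK (ks T) × Reversible (ks T) × (ks⁻¹ (ks T) ≅ T)
proposition4p14 T total = ks-total T total , ks-reversible T , ks⁻¹∘ks≅id T
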